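{- Let $G$ be a graph with $V(G)=\{v_1,\ldots,v_n\}$ and let $q\ge 2$ be an integer. Let $G^*$ be the graph obtained from $G$ by adding, for each $i\in[n]$, new vertices $A^i=\{a^i_1,\ldots,a^i_{q-1}\}$, $B^i=\{b^i_1,\ldots,b^i_q\}$, $C^i=\{c^i_1,\ldots,c^i_q\}$, together with the edges $v_ia^i_j$ for all $j\in[q-1]$, all edges between vertices of $A^i\cup B^i$ (so $A^i\cup B^i$ induces $K_{2q-1}$), and all edges between vertices of $B^i\cup C^i$ (so $B^i\cup C^i$ induces $K_{2q}$). Then $F_q(G^*)=Z(G)$.
   Context: All graphs are finite, simple and undirected. For $q\in\mathbb{N}$, the $q$-forcing color change rule is: if a blue vertex $u$ has at most $q$ white neighbors, then all white neighbors of $u$ become blue. A set $S\subseteq V(G)$ is a $q$-forcing set of $G$ if, when exactly the vertices of $S$ are initially blue and all others white, repeated application of this rule eventually makes all vertices blue. $F_q(G)$ is the minimum size of a $q$-forcing set of $G$, and the zero forcing number is $Z(G)=F_1(G)$. $[n]=\{1,\ldots,n\}$. -}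

module Defs where

open import Data.Nat using (ℕ; _+_; _*_; _∸_; _≤_)
open import Data.Bool using (Bool; true; false; _∧_; not)
open import Data.Fin using (Fin; splitAt; remQuot)
open import Data.Fin.Properties using (_≟_)
open import Data.Fin.Subset using (Subset; _∈_; _∩_; _∪_; ∁; ∣_∣; ⊤)
open import Data.Vec using (tabulate)
open import Data.Sum using (_⊎_; inj₁; inj₂)
open import Data.Product using (Σ; _×_; _,_)
open import Relation.Nullary.Decidable using (⌊_⌋)
open import Relation.Binary.PropositionalEquality using (_≡_)

record Graph : Set where
  field
    N       : ℕ
    adj     : Fin N → Fin N → Bool
    sym     : ∀ u v → adj u v ≡ adj v u
    irrefl  : ∀ v → adj v v ≡ false
open Graph public

nbhd : {N : ℕ} → (Fin N → Fin N → Bool) → Fin N → Subset N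
nbhd adj u = tabulate (λ v → adj u v)

data Reach {N : ℕ} (q : ℕ) (adj : Fin N → Fin N → Bool) (S : Subset N) : Subset N → Set where
  start : Reach q adj S S
  step  : ∀ {B} (u : Fin N) → Reach q adj S B → u ∈ B →
          ∣ nbhd adj u ∩ ∁ B ∣ ≤ q →
          Reach q adj S (B ∪ nbhd adj u)

IsForcingSet : {N : ℕ} → ℕ → (Fin N → Fin N → Bool) → Subset N → Set
IsForcingSet q adj S = Reach q adj S ⊤

IsForcingNumber : {N : ℕ} → ℕ → (Fin N → Fin N → Bool) → ℕ → Set
IsForcingNumber {N} q adj k =
  Σ (Subset N) (λ S → IsForcingSet q adj S × ∣ S ∣ ≡ k)
  × (∀ (S : Subset N) → IsForcingSet q adj S → k ≤ ∣ S ∣)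

IsZeroForcingNumber : Graph → ℕ → Set
IsZeroForcingNumber G k = IsForcingNumber 1 (adj G) k

data Vtx (n q : ℕ) : Set where
  vV : Fin n → Vtx n q
  vA : Fin n → Fin (q ∸ 1) → Vtx n q
  vB : Fin n → Fin q → Vtx n q
  vC : Fin n → Fin q → Vtx n q

eqF : {m : ℕ} → Fin m → Fin m → Bool
eqF i j = ⌊ i ≟ j ⌋

neqF : {m : ℕ} → Fin m → Fin m → Bool
neqF i j = not (eqF i j)

adjStarV : (G : Graph) (q : ℕ) → Vtx (N G) q → Vtx (N G) q → Bool
adjStarV G q (vV i)   (vV j)    = adj G i j
adjStarV G q (vV i)   (vA i' _) = eqF i i'
adjStarV G q (vA i _) (vV i')   = eqF i i'
adjStarV G q (vA i j) (vA i' j') = eqF i i' ∧ neqF j j'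
adjStarV G q (vA i _) (vB i' _) = eqF i i'
adjStarV G q (vB i _) (vA i' _) = eqF i i'
adjStarV G q (vB i j) (vB i' j') = eqF i i' ∧ neqF j j'
adjStarV G q (vB i _) (vC i' _) = eqF i i'
adjStarV G q (vC i _) (vB i' _) = eqF i i'
adjStarV G q (vC i j) (vC i' j') = eqF i i' ∧ neqF j j'
adjStarV G q _ _ = false

NStar : ℕ → ℕ → ℕ
NStar n q = n + (n * (q ∸ 1) + (n * q + n * q))

decode : (n q : ℕ) → Fin (NStar n q) → Vtx n q
decode n q x with splitAt n x
... | inj₁ i = vV i
... | inj₂ y with splitAt (n * (q ∸ 1)) y
...   | inj₁ z with remQuot {n} (q ∸ 1) z
...     | (i , j) = vA i j
decode n q x | inj₂ y | inj₂ w with splitAt (n * q) w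
...   | inj₁ z with remQuot {n} q z
...     | (i , j) = vB i j
decode n q x | inj₂ y | inj₂ w | inj₂ z with remQuot {n} q z
...     | (i , j) = vC i j

adjStar : (G : Graph) (q : ℕ) → Fin (NStar (N G) q) → Fin (NStar (N G) q) → Bool
adjStar G q x y = adjStarV G q (decode (N G) q x) (decode (N G) q y)

module Submission where

-- If S is a zero forcing set of G, its copy on the vertices v_i is a q-forcing set of G*: a
-- force of u in G is replayed by v_u, whose only other white neighbours are the q − 1 vertices
-- of A^u, and once every v_i is blue each gadget is coloured along v_i → A^i → B^i → C^i.
--
-- Conversely, run a q-forcing process of G* from S* alongside a zero forcing process of G whose
-- initial set is enlarged on the way, charging every added vertex to a gadget. A force from a
-- blue v_i with k white neighbours in G is simulated by first adding k − 1 of them; as v_i sees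
-- at most q white vertices, k − 1 is at most the number of blue vertices of A^i. The first force
-- from inside A^i ∪ B^i ∪ C^i needs q − 1 blue vertices there, plus one if v_i is white (q if it
-- comes from B^i ∪ C^i); these all lie in S*, and they pay for adding v_i and for every later
-- force from v_i. So gadget i is charged at most |S* ∩ (A^i ∪ B^i ∪ C^i)|, and Z(G) ≤ F_q(G*).

open import Data.Bool using (Bool; true; false; _∧_; _∨_; not; if_then_else_)
open import Data.Bool.Properties using (∧-zeroʳ; ∧-inverseʳ; ∨-zeroʳ; ∨-identityʳ)
open import Data.Fin using (Fin; zero; suc; _↑ˡ_; _↑ʳ_; combine; splitAt; remQuot)
open import Data.Fin.Properties
  using (_≟_; splitAt-↑ˡ; splitAt-↑ʳ; splitAt⁻¹-↑ˡ; splitAt⁻¹-↑ʳ; remQuot-combine; combine-remQuot)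
  renaming (suc-injective to Fin-suc-injective)
open import Data.Fin.Subset using (Subset; _∈_; _⊆_; _∩_; _∪_; ∁; ∣_∣; ⊤)
open import Data.Fin.Subset.Properties
  using (⊆⊤; ⊆-antisym; p⊆p∪q; q⊆p∪q; p⊆q⇒∣p∣≤∣q∣; p⊆q⇒∁p⊇∁q; x∈p∩q⁺; x∈p∩q⁻; ∪-assoc; ∪-comm)
open import Data.List using (List; []; _∷_; allFin)
open import Data.List.Membership.Propositional using () renaming (_∈_ to _∈ₗ_)
open import Data.List.Membership.Propositional.Properties using (∈-allFin)
open import Data.List.Relation.Unary.Any using (here; there)
open import Data.Nat using (ℕ; zero; suc; _+_; _*_; _∸_; _≤_; z≤n; s≤s)
open import Data.Nat.Properties
  using ( +-0-commutativeMonoid; +-assoc; +-comm; +-identityʳ; +-suc; suc-injective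
        ; ≤-refl; ≤-reflexive; ≤-trans; ≤-antisym; +-mono-≤; +-monoˡ-≤; +-monoʳ-≤; +-cancelʳ-≤; ∸-monoˡ-≤
        ; m≤m+n; m≤n+m; n≤1+n; m+n≤o⇒n≤o; module ≤-Reasoning )
open import Algebra.Properties.CommutativeMonoid.Sum +-0-commutativeMonoid
  using (sum; sum-cong-≗; sum-replicate-zero; ∑-distrib-+)
open import Data.Nat.Tactic.RingSolver using (solve-∀)
open import Data.Product using (∃; _×_; _,_; proj₁; proj₂)
open import Data.Sum using (inj₁; inj₂)
open import Data.Vec using ([]; _∷_; lookup; tabulate)
open import Data.Vec.Properties
  using (lookup∘tabulate; lookup-zipWith; lookup-map; lookup-replicate; lookup⇒[]=; []=⇒lookup)
open import Function using (_∘_; id)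
open import Relation.Binary.PropositionalEquality
open import Relation.Nullary using (yes; no)
open import Relation.Nullary.Decidable using (isYes≗does; dec-true; dec-false)

open import Defs hiding (sym)

-- Finite sums and counting

toℕ : Bool → ℕ
toℕ false = 0
toℕ true  = 1

toℕ≤1 : ∀ b → toℕ b ≤ 1
toℕ≤1 false = z≤n
toℕ≤1 true  = ≤-refl

toℕ-not-antitone : ∀ {a b} → (a ≡ true → b ≡ true) → toℕ (not b) ≤ toℕ (not a)
toℕ-not-antitone {true}          a⇒b rewrite a⇒b refl = z≤n
toℕ-not-antitone {false} {true}  _   = z≤n
toℕ-not-antitone {false} {false} _   = ≤-refl

count : ∀ {m} → (Fin m → Bool) → ℕ
count f = sum (λ x → toℕ (f x))

sum-mono-≤ : ∀ {m} {f g : Fin m → ℕ} → (∀ x → f x ≤ g x) → sum f ≤ sum g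
sum-mono-≤ {zero}  f≤g = z≤n
sum-mono-≤ {suc m} f≤g = +-mono-≤ (f≤g zero) (sum-mono-≤ (λ x → f≤g (suc x)))

sum-zero : ∀ {m} {f : Fin m → ℕ} → (∀ x → f x ≡ 0) → sum f ≡ 0
sum-zero {m} f≡0 = trans (sum-cong-≗ f≡0) (sum-replicate-zero m)

sum-↑ : ∀ a {b} (f : Fin (a + b) → ℕ) →
        sum f ≡ sum (λ i → f (i ↑ˡ b)) + sum (λ j → f (a ↑ʳ j))
sum-↑ zero    f = refl
sum-↑ (suc a) f = trans (cong (f zero +_) (sum-↑ a (λ x → f (suc x))))
                        (sym (+-assoc (f zero) _ _))

sum-combine : ∀ m {k} (f : Fin (m * k) → ℕ) →
              sum f ≡ sum (λ i → sum (λ j → f (combine {m} {k} i j)))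
sum-combine zero    f = refl
sum-combine (suc m) {k} f =
  trans (sum-↑ k f) (cong (sum (λ j → f (j ↑ˡ (m * k))) +_) (sum-combine m (λ y → f (k ↑ʳ y))))

sum-point : ∀ {m} (i : Fin m) (f : Fin m → ℕ) → (∀ k → i ≢ k → f k ≡ 0) → sum f ≡ f i
sum-point zero    f f≡0 = trans (cong (f zero +_) (sum-zero (λ k → f≡0 (suc k) λ ())))
                                (+-identityʳ _)
sum-point (suc i) f f≡0 = trans (cong (_+ sum (λ k → f (suc k))) (f≡0 zero λ ()))
                                (sum-point i (λ k → f (suc k)) (λ k i≢k → f≡0 (suc k) (i≢k ∘ Fin-suc-injective)))

eqF-refl : ∀ {m} (i : Fin m) → eqF i i ≡ true
eqF-refl i = trans (isYes≗does (i ≟ i)) (dec-true (i ≟ i) refl)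

eqF-≢ : ∀ {m} {i k : Fin m} → i ≢ k → eqF i k ≡ false
eqF-≢ {i = i} {k} i≢k = trans (isYes≗does (i ≟ k)) (dec-false (i ≟ k) i≢k)

eqF⇒≡ : ∀ {m} {i k : Fin m} → eqF i k ≡ true → i ≡ k
eqF⇒≡ {i = i} {k} e with i ≟ k
... | yes i≡k = i≡k

sum-diagonal : ∀ {m} (i : Fin m) (g : Bool → Fin m → ℕ) → (∀ k → g false k ≡ 0) →
               sum (λ k → g (eqF i k) k) ≡ g true i
sum-diagonal i g g0 =
  trans (sum-point i _ (λ k i≢k → trans (cong (λ b → g b k) (eqF-≢ i≢k)) (g0 k)))
        (cong (λ b → g b i) (eqF-refl i))

sum-block : ∀ {m k} (i : Fin m) (g : Bool → Fin m → Fin k → ℕ) → (∀ i' j → g false i' j ≡ 0) →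
            sum (λ i' → sum (λ j → g (eqF i i') i' j)) ≡ sum (λ j → g true i j)
sum-block i g g0 = sum-diagonal i (λ b i' → sum (λ j → g b i' j)) (λ i' → sum-zero (g0 i'))

sum²-zero : ∀ {m k} → sum {m} (λ _ → sum {k} (λ _ → 0)) ≡ 0
sum²-zero {m} {k} = sum-zero {m} {λ _ → sum {k} (λ _ → 0)} (λ _ → sum-replicate-zero k)

count-complement : ∀ {m} (f : Fin m → Bool) → count f + count (λ x → not (f x)) ≡ m
count-complement {zero}  f = refl
count-complement {suc m} f with f zero
... | true  = cong suc (count-complement (λ x → f (suc x)))
... | false = trans (+-suc _ _) (cong suc (count-complement (λ x → f (suc x))))

count≤ : ∀ {m} (f : Fin m → Bool) → count f ≤ m
count≤ f = subst (count f ≤_) (count-complement f) (m≤m+n _ _)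

count-mono : ∀ {m} {f g : Fin m → Bool} → (∀ x → f x ≡ true → g x ≡ true) → count f ≤ count g
count-mono {f = f} {g} f⇒g = sum-mono-≤ pointwise
  where
  pointwise : ∀ x → toℕ (f x) ≤ toℕ (g x)
  pointwise x with f x in fx
  ... | false = z≤n
  ... | true  = ≤-reflexive (cong toℕ (sym (f⇒g x fx)))

count-false : ∀ {m} {f : Fin m → Bool} → (∀ x → f x ≡ false) → count f ≡ 0
count-false f≡false = sum-zero (λ x → cong toℕ (f≡false x))

count-not≡0 : ∀ {m} {f : Fin m → Bool} → (∀ x → f x ≡ true) → count (λ x → not (f x)) ≡ 0
count-not≡0 all-true = count-false (cong not ∘ all-true)

count-remove : ∀ {m} (w : Fin m) (f : Fin m → Bool) →
               count f ≡ toℕ (f w) + count (λ x → neqF w x ∧ f x)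
count-remove w f = begin
  count f                                                ≡⟨ sum-cong-≗ (λ x → split (eqF w x) (f x)) ⟩
  sum (λ x → toℕ (eqF w x ∧ f x) + toℕ (neqF w x ∧ f x)) ≡⟨ ∑-distrib-+ at-w _ ⟩
  sum at-w + rest                                        ≡⟨ cong (_+ rest) at-w≡ ⟩
  toℕ (f w) + rest                                       ∎
  where
  open ≡-Reasoning
  at-w = λ x → toℕ (eqF w x ∧ f x)
  at-w≡ : sum at-w ≡ toℕ (f w)
  at-w≡ = sum-diagonal w (λ b x → toℕ (b ∧ f x)) (λ _ → refl)
  rest = count (λ x → neqF w x ∧ f x)
  split : ∀ b c → toℕ c ≡ toℕ (b ∧ c) + toℕ (not b ∧ c)
  split true  c = sym (+-identityʳ _)
  split false c = refl

count-others : ∀ {m} (w : Fin m) (f : Fin m → Bool) → f w ≡ false →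
               count (λ x → neqF w x ∧ f x) ≡ count f
count-others w f fw≡false =
  sym (trans (count-remove w f) (cong (λ b → toℕ b + count (λ x → neqF w x ∧ f x)) fw≡false))

count-witness : ∀ {m} (f : Fin m → Bool) {c} → count f ≡ suc c → ∃ λ w → f w ≡ true
count-witness {suc m} f count≡1+c with f zero in f0
... | true  = zero , f0
... | false with count-witness (λ x → f (suc x)) count≡1+c
...   | w , fw = suc w , fw

count-suc : ∀ {m} (f : Fin m → Bool) {c} → count f ≡ suc c →
            ∃ λ w → f w ≡ true × count (λ x → neqF w x ∧ f x) ≡ c
count-suc f {c} count≡1+c with count-witness f count≡1+c
... | w , fw = w , fw , suc-injective (begin
  suc (count (λ x → neqF w x ∧ f x))         ≡⟨ cong (λ b → toℕ b + count (λ x → neqF w x ∧ f x)) fw ⟨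
  toℕ (f w) + count (λ x → neqF w x ∧ f x)   ≡⟨ count-remove w f ⟨
  count f                                    ≡⟨ count≡1+c ⟩
  suc c                                      ∎)
  where open ≡-Reasoning

count-eqF : ∀ {m} (w : Fin m) → count (eqF w) ≡ 1
count-eqF w = sum-diagonal w (λ b _ → toℕ b) (λ _ → refl)

drop-one : ∀ {m} (f : Fin m → Bool) →
           ∃ λ f' → count f' ≡ count f ∸ 1 × count (λ x → f x ∧ not (f' x)) ≤ 1
drop-one f with count f in count-f
... | zero  = f , count-f , ≤-trans (≤-reflexive (count-false (∧-inverseʳ ∘ f))) z≤n
... | suc c with count-suc f count-f
...   | w , fw , count-rest = (λ x → neqF w x ∧ f x) , count-rest ,
                              ≤-trans (sum-mono-≤ (λ x → only-w (eqF w x) (f x))) (≤-reflexive (count-eqF w))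
  where
  only-w : ∀ e b → toℕ (b ∧ not (not e ∧ b)) ≤ toℕ e
  only-w e     false = z≤n
  only-w true  true  = ≤-refl
  only-w false true  = z≤n

-- Subsets and forcing processes

∣p∣≡count : ∀ {m} (p : Subset m) → ∣ p ∣ ≡ count (lookup p)
∣p∣≡count []          = refl
∣p∣≡count (true ∷ p)  = cong suc (∣p∣≡count p)
∣p∣≡count (false ∷ p) = ∣p∣≡count p

∣tabulate∣≡count : ∀ {m} (f : Fin m → Bool) → ∣ tabulate f ∣ ≡ count f
∣tabulate∣≡count f = trans (∣p∣≡count (tabulate f)) (sum-cong-≗ (cong toℕ ∘ lookup∘tabulate f))

lookup-∪ : ∀ {m} (p r : Subset m) x → lookup (p ∪ r) x ≡ lookup p x ∨ lookup r x
lookup-∪ p r x = lookup-zipWith _∨_ x p r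

lookup-∪-nbhd : ∀ {m} (adj : Fin m → Fin m → Bool) u (B : Subset m) x →
                lookup (B ∪ nbhd adj u) x ≡ lookup B x ∨ adj u x
lookup-∪-nbhd adj u B x =
  trans (lookup-∪ B (nbhd adj u) x) (cong (lookup B x ∨_) (lookup∘tabulate (adj u) x))

∣p∪q∣≤∣p∣+∣q∣ : ∀ {m} (p r : Subset m) → ∣ p ∪ r ∣ ≤ ∣ p ∣ + ∣ r ∣
∣p∪q∣≤∣p∣+∣q∣ p r = begin
  ∣ p ∪ r ∣                                       ≡⟨ ∣p∣≡count (p ∪ r) ⟩
  count (lookup (p ∪ r))                          ≤⟨ sum-mono-≤ pointwise ⟩
  sum (λ x → toℕ (lookup p x) + toℕ (lookup r x)) ≡⟨ ∑-distrib-+ (λ x → toℕ (lookup p x)) _ ⟩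
  count (lookup p) + count (lookup r)             ≡⟨ cong₂ _+_ (∣p∣≡count p) (∣p∣≡count r) ⟨
  ∣ p ∣ + ∣ r ∣                                   ∎
  where
  open ≤-Reasoning
  ∨≤+ : ∀ a b → toℕ (a ∨ b) ≤ toℕ a + toℕ b
  ∨≤+ true  b = s≤s z≤n
  ∨≤+ false b = ≤-refl
  pointwise : ∀ x → toℕ (lookup (p ∪ r) x) ≤ toℕ (lookup p x) + toℕ (lookup r x)
  pointwise x = subst (λ b → toℕ b ≤ toℕ (lookup p x) + toℕ (lookup r x)) (sym (lookup-∪ p r x))
                      (∨≤+ (lookup p x) (lookup r x))

white-count : ∀ {m} (adj : Fin m → Fin m → Bool) u (B : Subset m) →
              ∣ nbhd adj u ∩ ∁ B ∣ ≡ count (λ x → adj u x ∧ not (lookup B x))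
white-count adj u B = trans (∣p∣≡count (nbhd adj u ∩ ∁ B)) (sum-cong-≗ λ x → cong toℕ
  (trans (lookup-zipWith _∧_ x (nbhd adj u) (∁ B)) (cong₂ _∧_ (lookup∘tabulate (adj u) x) (lookup-map x not B))))

Reach-∪ : ∀ {m q adj} {S T : Subset m} (X : Subset m) → Reach q adj S T → Reach q adj (S ∪ X) (T ∪ X)
Reach-∪ X start = start
Reach-∪ {q = q} {adj} {S} X (step {B} u r u∈B whites≤q) =
  subst (Reach q adj (S ∪ X)) (∪-swap (nbhd adj u))
        (step u (Reach-∪ X r) (p⊆p∪q X u∈B) (≤-trans (p⊆q⇒∣p∣≤∣q∣ fewer-whites) whites≤q))
  where
  fewer-whites : nbhd adj u ∩ ∁ (B ∪ X) ⊆ nbhd adj u ∩ ∁ B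
  fewer-whites x∈ with x∈p∩q⁻ _ _ x∈
  ... | x∈N , x∉B∪X = x∈p∩q⁺ (x∈N , p⊆q⇒∁p⊇∁q (p⊆p∪q X) x∉B∪X)
  ∪-swap : ∀ Y → (B ∪ X) ∪ Y ≡ (B ∪ Y) ∪ X
  ∪-swap Y = trans (∪-assoc B X Y) (trans (cong (B ∪_) (∪-comm X Y)) (sym (∪-assoc B Y X)))

force-after-seeding : ∀ {m adj} {S T : Subset m} u → Reach 1 adj S T → u ∈ T →
  ∃ λ X → Reach 1 adj (S ∪ X) ((T ∪ X) ∪ nbhd adj u) × ∣ X ∣ ≡ ∣ nbhd adj u ∩ ∁ T ∣ ∸ 1
force-after-seeding {adj = adj} {S} {T} u r u∈T with drop-one (λ x → adj u x ∧ not (lookup T x))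
... | X , count-X , whites-left≤1 =
  tabulate X , step u (Reach-∪ (tabulate X) r) (p⊆p∪q _ u∈T) whites≤1 ,
  trans (∣tabulate∣≡count X) (trans count-X (cong (_∸ 1) (sym (white-count adj u T))))
  where
  ∧-not-∨ : ∀ a t x → a ∧ not (t ∨ x) ≡ (a ∧ not t) ∧ not x
  ∧-not-∨ false t     x = refl
  ∧-not-∨ true  true  x = refl
  ∧-not-∨ true  false x = refl
  whites≤1 : ∣ nbhd adj u ∩ ∁ (T ∪ tabulate X) ∣ ≤ 1
  whites≤1 = ≤-trans (≤-reflexive (trans (white-count adj u (T ∪ tabulate X)) (sum-cong-≗ λ x → cong toℕ
               (trans (cong (λ b → adj u x ∧ not b) (trans (lookup-∪ T (tabulate X) x)
                                                          (cong (lookup T x ∨_) (lookup∘tabulate X x))))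
                      (∧-not-∨ (adj u x) (lookup T x) (X x))))))
             whites-left≤1

forcing-number-transfer :
  ∀ {m m' q q'} {adj : Fin m → Fin m → Bool} {adj' : Fin m' → Fin m' → Bool} {k}
  (lift : Subset m → Subset m') →
  (∀ S → IsForcingSet q adj S → IsForcingSet q' adj' (lift S)) → (∀ S → ∣ lift S ∣ ≡ ∣ S ∣) →
  (∀ S' → IsForcingSet q' adj' S' → ∃ λ S → IsForcingSet q adj S × ∣ S ∣ ≤ ∣ S' ∣) →
  (IsForcingNumber q adj k → IsForcingNumber q' adj' k) × (IsForcingNumber q' adj' k → IsForcingNumber q adj k)
forcing-number-transfer {k = k} lift lift-forcing ∣lift∣ descend = to , from
  where
  to : IsForcingNumber _ _ k → IsForcingNumber _ _ k
  to ((S , S-forcing , ∣S∣≡k) , minimal) =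
    (lift S , lift-forcing S S-forcing , trans (∣lift∣ S) ∣S∣≡k) ,
    λ S' S'-forcing → let (S₀ , S₀-forcing , ∣S₀∣≤) = descend S' S'-forcing
                      in ≤-trans (minimal S₀ S₀-forcing) ∣S₀∣≤
  from : IsForcingNumber _ _ k → IsForcingNumber _ _ k
  from ((S' , S'-forcing , ∣S'∣≡k) , minimal) =
    (S₀ , S₀-forcing , ≤-antisym (subst (∣ S₀ ∣ ≤_) ∣S'∣≡k ∣S₀∣≤) (minimal₀ S₀ S₀-forcing)) , minimal₀
    where
    minimal₀ : ∀ S → IsForcingSet _ _ S → k ≤ ∣ S ∣
    minimal₀ S S-forcing = subst (k ≤_) (∣lift∣ S) (minimal (lift S) (lift-forcing S S-forcing))
    S₀ = proj₁ (descend S' S'-forcing)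
    S₀-forcing = proj₁ (proj₂ (descend S' S'-forcing))
    ∣S₀∣≤ = proj₂ (proj₂ (descend S' S'-forcing))

-- The vertices of G*

module _ {n q : ℕ} where

  encode : Vtx n q → Fin (NStar n q)
  encode (vV i)   = i ↑ˡ _
  encode (vA i j) = n ↑ʳ (combine i j ↑ˡ _)
  encode (vB i j) = n ↑ʳ (n * (q ∸ 1) ↑ʳ (combine i j ↑ˡ _))
  encode (vC i j) = n ↑ʳ (n * (q ∸ 1) ↑ʳ (n * q ↑ʳ combine i j))

  decode-encode : ∀ v → decode n q (encode v) ≡ v
  decode-encode (vV i)
    rewrite splitAt-↑ˡ n i (n * (q ∸ 1) + (n * q + n * q)) = refl
  decode-encode (vA i j)
    rewrite splitAt-↑ʳ n (n * (q ∸ 1) + (n * q + n * q)) (combine i j ↑ˡ (n * q + n * q))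
          | splitAt-↑ˡ (n * (q ∸ 1)) (combine i j) (n * q + n * q)
    = cong (λ (i , j) → vA i j) (remQuot-combine i j)
  decode-encode (vB i j)
    rewrite splitAt-↑ʳ n (n * (q ∸ 1) + (n * q + n * q)) (n * (q ∸ 1) ↑ʳ (combine i j ↑ˡ (n * q)))
          | splitAt-↑ʳ (n * (q ∸ 1)) (n * q + n * q) (combine i j ↑ˡ (n * q))
          | splitAt-↑ˡ (n * q) (combine i j) (n * q)
    = cong (λ (i , j) → vB i j) (remQuot-combine i j)
  decode-encode (vC i j)
    rewrite splitAt-↑ʳ n (n * (q ∸ 1) + (n * q + n * q)) (n * (q ∸ 1) ↑ʳ (n * q ↑ʳ combine i j))
          | splitAt-↑ʳ (n * (q ∸ 1)) (n * q + n * q) (n * q ↑ʳ combine i j)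
          | splitAt-↑ʳ (n * q) (n * q) (combine i j)
    = cong (λ (i , j) → vC i j) (remQuot-combine i j)

  encode-decode : ∀ x → encode (decode n q x) ≡ x
  encode-decode x with splitAt n x in x≡
  ... | inj₁ i = splitAt⁻¹-↑ˡ x≡
  ... | inj₂ y with splitAt (n * (q ∸ 1)) y in y≡
  ...   | inj₁ z with remQuot {n} (q ∸ 1) z | combine-remQuot {n} (q ∸ 1) z
  ...     | i , j | z≡ = trans (cong (n ↑ʳ_) (trans (cong (_↑ˡ _) z≡) (splitAt⁻¹-↑ˡ y≡))) (splitAt⁻¹-↑ʳ x≡)
  encode-decode x | inj₂ y | inj₂ w with splitAt (n * q) w in w≡
  ...   | inj₁ z with remQuot {n} q z | combine-remQuot {n} q z
  ...     | i , j | z≡ = trans (cong (n ↑ʳ_) (trans (cong (n * (q ∸ 1) ↑ʳ_)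
                           (trans (cong (_↑ˡ _) z≡) (splitAt⁻¹-↑ˡ w≡))) (splitAt⁻¹-↑ʳ y≡))) (splitAt⁻¹-↑ʳ x≡)
  encode-decode x | inj₂ y | inj₂ w | inj₂ z with remQuot {n} q z | combine-remQuot {n} q z
  ...     | i , j | z≡ = trans (cong (n ↑ʳ_) (trans (cong (n * (q ∸ 1) ↑ʳ_)
                           (trans (cong (n * q ↑ʳ_) z≡) (splitAt⁻¹-↑ʳ w≡))) (splitAt⁻¹-↑ʳ y≡))) (splitAt⁻¹-↑ʳ x≡)

  ∑Vtx : (Vtx n q → ℕ) → ℕ
  ∑Vtx h = sum (λ i → h (vV i))
         + (sum (λ i → sum (λ j → h (vA i j)))
         + (sum (λ i → sum (λ j → h (vB i j)))
         +  sum (λ i → sum (λ j → h (vC i j)))))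

  sum-encode : (f : Fin (NStar n q) → ℕ) → sum f ≡ ∑Vtx (f ∘ encode)
  sum-encode f
    rewrite sum-↑ n f
          | sum-↑ (n * (q ∸ 1)) (λ y → f (n ↑ʳ y))
          | sum-↑ (n * q) (λ y → f (n ↑ʳ (n * (q ∸ 1) ↑ʳ y)))
          | sum-combine n (λ y → f (n ↑ʳ (y ↑ˡ (n * q + n * q))))
          | sum-combine n (λ y → f (n ↑ʳ (n * (q ∸ 1) ↑ʳ (y ↑ˡ n * q))))
          | sum-combine n (λ y → f (n ↑ʳ (n * (q ∸ 1) ↑ʳ (n * q ↑ʳ y)))) = refl

  ∑Vtx-parts : ∀ (h : Vtx n q → ℕ) {a b c d} →
    sum (λ i → h (vV i)) ≡ a → sum (λ i → sum (λ j → h (vA i j))) ≡ b →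
    sum (λ i → sum (λ j → h (vB i j))) ≡ c → sum (λ i → sum (λ j → h (vC i j))) ≡ d →
    ∑Vtx h ≡ a + (b + (c + d))
  ∑Vtx-parts h eV eA eB eC = cong₂ _+_ eV (cong₂ _+_ eA (cong₂ _+_ eB eC))

  ∑Vtx-cong : ∀ {f g : Vtx n q → ℕ} → (∀ w → f w ≡ g w) → ∑Vtx f ≡ ∑Vtx g
  ∑Vtx-cong {f} f≡g = ∑Vtx-parts f (sum-cong-≗ (f≡g ∘ vV)) (sum-cong-≗ λ i → sum-cong-≗ (f≡g ∘ vA i))
                             (sum-cong-≗ λ i → sum-cong-≗ (f≡g ∘ vB i)) (sum-cong-≗ λ i → sum-cong-≗ (f≡g ∘ vC i))

module Star (G : Graph) (q : ℕ) where

  n : ℕ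
  n = N G

  adj* : Fin (NStar n q) → Fin (NStar n q) → Bool
  adj* = adjStar G q

  Colouring : Set
  Colouring = Vtx n q → Bool

  colouring : Subset (NStar n q) → Colouring
  colouring B w = lookup B (encode w)

  whiteNbr : Vtx n q → Colouring → Vtx n q → ℕ
  whiteNbr v β w = toℕ (adjStarV G q v w ∧ not (β w))

  whites : Vtx n q → Colouring → ℕ
  whites v β = ∑Vtx (whiteNbr v β)

  adj*-encode : ∀ v w → adj* (encode v) (encode w) ≡ adjStarV G q v w
  adj*-encode v w = cong₂ (adjStarV G q) (decode-encode v) (decode-encode w)

  whites-encode : ∀ v (B : Subset (NStar n q)) → ∣ nbhd adj* (encode v) ∩ ∁ B ∣ ≡ whites v (colouring B)
  whites-encode v B = trans (white-count adj* (encode v) B) (trans (sum-encode {n} {q} _)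
    (∑Vtx-cong λ w → cong (λ b → toℕ (b ∧ not (colouring B w))) (adj*-encode v w)))

  _⊕_ : Colouring → Vtx n q → Colouring
  (β ⊕ v) w = β w ∨ adjStarV G q v w

  colouring-force : ∀ B (v : Vtx n q) w → colouring (B ∪ nbhd adj* (encode v)) w ≡ (colouring B ⊕ v) w
  colouring-force B v w = trans (lookup-∪-nbhd adj* (encode v) B (encode w))
                                (cong (colouring B w ∨_) (adj*-encode v w))

  owner : Vtx n q → Fin n
  owner (vV i)   = i
  owner (vA i _) = i
  owner (vB i _) = i
  owner (vC i _) = i

  nonadjacent : ∀ v {k} → owner v ≢ k →
                (∀ j → adjStarV G q v (vA k j) ≡ false) × (∀ j → adjStarV G q v (vB k j) ≡ false)
                × (∀ j → adjStarV G q v (vC k j) ≡ false)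
  nonadjacent (vV i)   i≢k = (λ _ → eqF-≢ i≢k) , (λ _ → refl) , (λ _ → refl)
  nonadjacent (vA i _) i≢k = (λ _ → cong (_∧ _) (eqF-≢ i≢k)) , (λ _ → eqF-≢ i≢k) , (λ _ → refl)
  nonadjacent (vB i _) i≢k = (λ _ → eqF-≢ i≢k) , (λ _ → cong (_∧ _) (eqF-≢ i≢k)) , (λ _ → eqF-≢ i≢k)
  nonadjacent (vC i _) i≢k = (λ _ → refl) , (λ _ → eqF-≢ i≢k) , (λ _ → cong (_∧ _) (eqF-≢ i≢k))

  force : ∀ {S B} v → Reach q adj* S B → colouring B v ≡ true → whites v (colouring B) ≤ q →
          Reach q adj* S (B ∪ nbhd adj* (encode v))
  force {B = B} v r v-blue whites≤q =
    step (encode v) r (lookup⇒[]= (encode v) B v-blue) (subst (_≤ q) (sym (whites-encode v B)) whites≤q)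

  whiteG blueA whiteA blueB whiteB blueC whiteC : Fin n → Colouring → ℕ
  whiteG i β = count (λ i' → adj G i i' ∧ not (β (vV i')))
  blueA  i β = count (λ j → β (vA i j))
  whiteA i β = count (λ j → not (β (vA i j)))
  blueB  i β = count (λ j → β (vB i j))
  whiteB i β = count (λ j → not (β (vB i j)))
  blueC  i β = count (λ j → β (vC i j))
  whiteC i β = count (λ j → not (β (vC i j)))

  whites-vV : ∀ i β → whites (vV i) β ≡ whiteG i β + whiteA i β
  whites-vV i β =
    trans (∑Vtx-parts (whiteNbr (vV i) β) refl
                      (sum-block i (λ b i' j → toℕ (b ∧ not (β (vA i' j)))) (λ _ _ → refl))
                      (sum²-zero {n} {q}) (sum²-zero {n} {q}))
          (cong (whiteG i β +_) (+-identityʳ _))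

  whites-vA : ∀ i j β → β (vA i j) ≡ true →
              whites (vA i j) β ≡ toℕ (not (β (vV i))) + (whiteA i β + whiteB i β)
  whites-vA i j β a-blue =
    trans (∑Vtx-parts (whiteNbr (vA i j) β) (sum-diagonal i (λ b i' → toℕ (b ∧ not (β (vV i')))) (λ _ → refl))
                      (trans (sum-block i (λ b i' j' → toℕ ((b ∧ neqF j j') ∧ not (β (vA i' j')))) (λ _ _ → refl))
                             (count-others j (λ j' → not (β (vA i j'))) (cong not a-blue)))
                      (sum-block i (λ b i' j' → toℕ (b ∧ not (β (vB i' j')))) (λ _ _ → refl))
                      (sum²-zero {n} {q}))
          (cong (λ x → toℕ (not (β (vV i))) + (whiteA i β + x)) (+-identityʳ _))

  whites-vB : ∀ i j β → β (vB i j) ≡ true → whites (vB i j) β ≡ whiteA i β + (whiteB i β + whiteC i β)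
  whites-vB i j β b-blue =
    ∑Vtx-parts (whiteNbr (vB i j) β) (sum-replicate-zero n)
               (sum-block i (λ b i' j' → toℕ (b ∧ not (β (vA i' j')))) (λ _ _ → refl))
               (trans (sum-block i (λ b i' j' → toℕ ((b ∧ neqF j j') ∧ not (β (vB i' j')))) (λ _ _ → refl))
                      (count-others j (λ j' → not (β (vB i j'))) (cong not b-blue)))
               (sum-block i (λ b i' j' → toℕ (b ∧ not (β (vC i' j')))) (λ _ _ → refl))

  whites-vC : ∀ i j β → β (vC i j) ≡ true → whites (vC i j) β ≡ whiteB i β + whiteC i β
  whites-vC i j β c-blue =
    ∑Vtx-parts (whiteNbr (vC i j) β) (sum-replicate-zero n) (sum²-zero {n} {q ∸ 1})
               (sum-block i (λ b i' j' → toℕ (b ∧ not (β (vB i' j')))) (λ _ _ → refl))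
               (trans (sum-block i (λ b i' j' → toℕ ((b ∧ neqF j j') ∧ not (β (vC i' j')))) (λ _ _ → refl))
                      (count-others j (λ j' → not (β (vC i j'))) (cong not c-blue)))

  colouring-⊆ : ∀ {B B'} → B ⊆ B' → ∀ w → colouring B w ≡ true → colouring B' w ≡ true
  colouring-⊆ {B} B⊆B' w w-blue = []=⇒lookup (B⊆B' (lookup⇒[]= (encode w) B w-blue))

  stays-blue : ∀ B (v : Vtx n q) w → colouring B w ≡ true → colouring (B ∪ nbhd adj* (encode v)) w ≡ true
  stays-blue B v = colouring-⊆ {B} (p⊆p∪q {p = B} (nbhd adj* (encode v)))

  forced : ∀ B (v : Vtx n q) w → adjStarV G q v w ≡ true → colouring (B ∪ nbhd adj* (encode v)) w ≡ true
  forced B v w vw = trans (colouring-force B v w) (trans (cong (colouring B w ∨_) vw) (∨-zeroʳ _))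

  all-blue⇒⊤ : ∀ B → (∀ w → colouring B w ≡ true) → B ≡ ⊤
  all-blue⇒⊤ B all-blue = ⊆-antisym ⊆⊤ λ {x} _ →
    subst (_∈ B) (encode-decode {n} {q} x) (lookup⇒[]= _ B (all-blue (decode n q x)))

module ZeroForcing⇒Forcing (G : Graph) (Q : ℕ) (a₀ : Fin Q) where

  open Star G (suc Q)

  onV : Subset n → Colouring
  onV S (vV i) = lookup S i
  onV S _      = false

  lift : Subset n → Subset (NStar n (suc Q))
  lift S = tabulate (onV S ∘ decode n (suc Q))

  colouring-lift : ∀ S w → colouring (lift S) w ≡ onV S w
  colouring-lift S w = trans (lookup∘tabulate _ (encode w)) (cong (onV S) (decode-encode w))

  ∣lift∣ : ∀ S → ∣ lift S ∣ ≡ ∣ S ∣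
  ∣lift∣ S = begin
    ∣ lift S ∣                              ≡⟨ ∣p∣≡count (lift S) ⟩
    count (lookup (lift S))                 ≡⟨ sum-encode {n} {suc Q} _ ⟩
    ∑Vtx (toℕ ∘ colouring (lift S))          ≡⟨ ∑Vtx-cong (cong toℕ ∘ colouring-lift S) ⟩
    ∑Vtx (toℕ ∘ onV S)                       ≡⟨ ∑Vtx-parts (toℕ ∘ onV S) refl (sum²-zero {n} {Q})
                                                             (sum²-zero {n} {suc Q}) (sum²-zero {n} {suc Q}) ⟩
    count (lookup S) + 0                    ≡⟨ +-identityʳ _ ⟩
    count (lookup S)                        ≡⟨ ∣p∣≡count S ⟨
    ∣ S ∣                                   ∎
    where open ≡-Reasoning

  simulate : ∀ S {T} → Reach 1 (adj G) S T →
             ∃ λ B → Reach (suc Q) adj* (lift S) B × (∀ i → colouring B (vV i) ≡ lookup T i)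
  simulate S start = lift S , start , colouring-lift S ∘ vV
  simulate S (step {T} u r u∈T whites≤1) with simulate S r
  ... | B , rB , B≈T = B ∪ nbhd adj* (encode (vV u)) , force (vV u) rB u-blue whites≤q , B'≈T'
    where
    β = colouring B
    u-blue : β (vV u) ≡ true
    u-blue = trans (B≈T u) ([]=⇒lookup u∈T)
    whiteG≤1 : whiteG u β ≤ 1
    whiteG≤1 = subst (_≤ 1) (trans (white-count (adj G) u T)
      (sum-cong-≗ λ i → cong (λ b → toℕ (adj G u i ∧ not b)) (sym (B≈T i)))) whites≤1
    whites≤q : whites (vV u) β ≤ suc Q
    whites≤q = subst (_≤ suc Q) (sym (whites-vV u β)) (+-mono-≤ whiteG≤1 (count≤ _))
    B'≈T' : ∀ i → colouring (B ∪ nbhd adj* (encode (vV u))) (vV i) ≡ lookup (T ∪ nbhd (adj G) u) i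
    B'≈T' i = trans (colouring-force B (vV u) (vV i))
                    (trans (cong (_∨ adj G u i) (B≈T i)) (sym (lookup-∪-nbhd (adj G) u T i)))

  GadgetBlue : Subset (NStar n (suc Q)) → Fin n → Set
  GadgetBlue B i = (∀ j → colouring B (vA i j) ≡ true)
                 × (∀ j → colouring B (vB i j) ≡ true)
                 × (∀ j → colouring B (vC i j) ≡ true)

  colour-gadget : ∀ {S B} i → Reach (suc Q) adj* S B → (∀ i → colouring B (vV i) ≡ true) →
                  ∃ λ B' → Reach (suc Q) adj* S B' × B ⊆ B' × GadgetBlue B' i
  colour-gadget {S} {B} i r V-blue = B₃ , r₃ , B⊆B₃ , A-blue₃ , B-blue₃ , C-blue₃
    where
    β = colouring B
    B₁ = B ∪ nbhd adj* (encode (vV i))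
    β₁ = colouring B₁
    B₂ = B₁ ∪ nbhd adj* (encode (vA i a₀))
    β₂ = colouring B₂
    B₃ = B₂ ∪ nbhd adj* (encode (vB i zero))

    A-blue₁ : ∀ j → β₁ (vA i j) ≡ true
    A-blue₁ j = forced B (vV i) (vA i j) (eqF-refl i)
    r₁ : Reach (suc Q) adj* S B₁
    r₁ = force (vV i) r (V-blue i)
           (subst (_≤ suc Q) (sym whites₁) (≤-trans (count≤ (λ j → not (β (vA i j)))) (n≤1+n Q)))
      where
      whites₁ : whites (vV i) β ≡ whiteA i β
      whites₁ = trans (whites-vV i β) (cong (_+ whiteA i β)
                  (count-false λ i' → trans (cong (λ b → adj G i i' ∧ not b) (V-blue i')) (∧-zeroʳ _)))

    A-blue₂ : ∀ j → β₂ (vA i j) ≡ true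
    A-blue₂ j = stays-blue B₁ (vA i a₀) (vA i j) (A-blue₁ j)
    B-blue₂ : ∀ j → β₂ (vB i j) ≡ true
    B-blue₂ j = forced B₁ (vA i a₀) (vB i j) (eqF-refl i)
    r₂ : Reach (suc Q) adj* S B₂
    r₂ = force (vA i a₀) r₁ (A-blue₁ a₀) (subst (_≤ suc Q) (sym whites₂) (count≤ (λ j → not (β₁ (vB i j)))))
      where
      whites₂ : whites (vA i a₀) β₁ ≡ whiteB i β₁
      whites₂ = trans (whites-vA i a₀ β₁ (A-blue₁ a₀))
                  (cong₂ (λ x y → toℕ (not x) + (y + whiteB i β₁))
                         (stays-blue B (vV i) (vV i) (V-blue i)) (count-not≡0 A-blue₁))

    r₃ : Reach (suc Q) adj* S B₃
    r₃ = force (vB i zero) r₂ (B-blue₂ zero) (subst (_≤ suc Q) (sym whites₃) (count≤ (λ j → not (β₂ (vC i j)))))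
      where
      whites₃ : whites (vB i zero) β₂ ≡ whiteC i β₂
      whites₃ = trans (whites-vB i zero β₂ (B-blue₂ zero))
                  (cong₂ (λ x y → x + (y + whiteC i β₂)) (count-not≡0 A-blue₂) (count-not≡0 B-blue₂))
    B⊆B₃ : B ⊆ B₃
    B⊆B₃ = p⊆p∪q {p = B₂} _ ∘ p⊆p∪q {p = B₁} _ ∘ p⊆p∪q {p = B} _
    A-blue₃ : ∀ j → colouring B₃ (vA i j) ≡ true
    A-blue₃ j = stays-blue B₂ (vB i zero) (vA i j) (A-blue₂ j)
    B-blue₃ : ∀ j → colouring B₃ (vB i j) ≡ true
    B-blue₃ j = stays-blue B₂ (vB i zero) (vB i j) (B-blue₂ j)
    C-blue₃ : ∀ j → colouring B₃ (vC i j) ≡ true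
    C-blue₃ j = forced B₂ (vB i zero) (vC i j) (eqF-refl i)

  GadgetBlue-⊆ : ∀ {B B'} → B ⊆ B' → ∀ i → GadgetBlue B i → GadgetBlue B' i
  GadgetBlue-⊆ B⊆B' i (A , B , C) = (λ j → colouring-⊆ B⊆B' (vA i j) (A j))
                                   , (λ j → colouring-⊆ B⊆B' (vB i j) (B j))
                                   , (λ j → colouring-⊆ B⊆B' (vC i j) (C j))

  colour-gadgets : ∀ {S B} (is : List (Fin n)) → Reach (suc Q) adj* S B → (∀ i → colouring B (vV i) ≡ true) →
                   ∃ λ B' → Reach (suc Q) adj* S B' × B ⊆ B' × (∀ i → i ∈ₗ is → GadgetBlue B' i)
  colour-gadgets []       r V-blue = _ , r , id , λ _ ()
  colour-gadgets (i ∷ is) r V-blue with colour-gadget i r V-blue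
  ... | B₁ , r₁ , B⊆B₁ , gadget-i with colour-gadgets is r₁ (λ k → colouring-⊆ B⊆B₁ (vV k) (V-blue k))
  ...   | B₂ , r₂ , B₁⊆B₂ , gadgets = B₂ , r₂ , B₁⊆B₂ ∘ B⊆B₁ , λ where
    .i (here refl) → GadgetBlue-⊆ B₁⊆B₂ i gadget-i
    k  (there k∈is) → gadgets k k∈is

  lift-forcing : ∀ S → IsForcingSet 1 (adj G) S → IsForcingSet (suc Q) adj* (lift S)
  lift-forcing S zf with simulate S zf
  ... | B , rB , B≈⊤ with colour-gadgets (allFin n) rB (λ i → trans (B≈⊤ i) (lookup-replicate i true))
  ...   | B' , rB' , B⊆B' , gadgets = subst (Reach (suc Q) adj* (lift S)) (all-blue⇒⊤ B' all-blue) rB'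
    where
    all-blue : ∀ w → colouring B' w ≡ true
    all-blue (vV i)   = colouring-⊆ B⊆B' (vV i) (trans (B≈⊤ i) (lookup-replicate i true))
    all-blue (vA i j) = proj₁ (gadgets i (∈-allFin i)) j
    all-blue (vB i j) = proj₁ (proj₂ (gadgets i (∈-allFin i))) j
    all-blue (vC i j) = proj₂ (proj₂ (gadgets i (∈-allFin i))) j

module Forcing⇒ZeroForcing (G : Graph) (Q : ℕ) (S* : Subset (NStar (N G) (suc Q))) where

  open Star G (suc Q)

  σ : Colouring
  σ = colouring S*

  blueGadget : Fin n → Colouring → ℕ
  blueGadget i β = blueA i β + (blueB i β + blueC i β)

  budget : Fin n → ℕ
  budget i = blueGadget i σ

  seedsV : Subset n
  seedsV = tabulate (σ ∘ vV)

  -- spent counts the vertices added to the zero forcing set of G on behalf of gadget i, to be paid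
  -- for by the S*-vertices of the gadget. A gadget stays untouched until a force enters it; once
  -- paid, its budget still covers q − 1 more vertices, and v_i while it is white; once done, v_i
  -- and all its neighbours in G are blue, so it needs nothing more.
  data GadgetState (β : Colouring) (i : Fin n) (spent : ℕ) : Set where
    untouched : spent ≡ 0 → blueGadget i β ≤ budget i → GadgetState β i spent
    paid      : spent + Q + toℕ (not (β (vV i))) ≤ budget i → GadgetState β i spent
    done      : spent ≤ budget i → β (vV i) ≡ true → (∀ i' → adj G i i' ≡ true → β (vV i') ≡ true) →
                GadgetState β i spent

  spent≤budget : ∀ {β i spent} → GadgetState β i spent → spent ≤ budget i
  spent≤budget (untouched refl _) = z≤n
  spent≤budget {spent = spent} (paid ≤budget) = ≤-trans (≤-trans (m≤m+n spent Q) (m≤m+n _ _)) ≤budget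
  spent≤budget (done ≤budget _ _) = ≤budget

  _⊑_ : Colouring → Colouring → Set
  β ⊑ β' = ∀ w → β w ≡ true → β' w ≡ true

  _⊑[_]_ : Colouring → Fin n → Colouring → Set
  β ⊑[ i ] β' = (∀ j → β (vA i j) ≡ true → β' (vA i j) ≡ true)
              × (∀ j → β (vB i j) ≡ true → β' (vB i j) ≡ true)
              × (∀ j → β (vC i j) ≡ true → β' (vC i j) ≡ true)

  ⊑⇒⊑[_] : ∀ i {β β'} → β ⊑ β' → β ⊑[ i ] β'
  ⊑⇒⊑[ i ] β⊑β' = (λ j → β⊑β' (vA i j)) , (λ j → β⊑β' (vB i j)) , (λ j → β⊑β' (vC i j))

  ⊑⊕ : ∀ β v → β ⊑ (β ⊕ v)
  ⊑⊕ β v w w-blue = cong (_∨ adjStarV G (suc Q) v w) w-blue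

  ⊕⊑[_] : ∀ k β v → owner v ≢ k → (β ⊕ v) ⊑[ k ] β
  ⊕⊑[ k ] β v v≢k with nonadjacent v v≢k
  ... | A , B , C = (λ j → ∨-false (A j)) , (λ j → ∨-false (B j)) , (λ j → ∨-false (C j))
    where
    ∨-false : ∀ {x y} → y ≡ false → x ∨ y ≡ true → x ≡ true
    ∨-false {x} refl x∨false = trans (sym (∨-identityʳ x)) x∨false

  GadgetState-⊑ : ∀ {β β' i spent} → β ⊑ β' →
                  (spent ≡ 0 → blueGadget i β ≤ budget i → GadgetState β' i spent) →
                  GadgetState β i spent → GadgetState β' i spent
  GadgetState-⊑ _ if-untouched (untouched spent≡0 ≤budget) = if-untouched spent≡0 ≤budget
  GadgetState-⊑ {i = i} β⊑β' _ (paid ≤budget) =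
    paid (≤-trans (+-monoʳ-≤ _ (toℕ-not-antitone (β⊑β' (vV i)))) ≤budget)
  GadgetState-⊑ β⊑β' _ (done ≤budget vi nbrs) = done ≤budget (β⊑β' _ vi) (λ i' a → β⊑β' _ (nbrs i' a))

  GadgetState-mono : ∀ {β β' i spent} → β ⊑ β' → β' ⊑[ i ] β → GadgetState β i spent → GadgetState β' i spent
  GadgetState-mono β⊑β' (A , B , C) = GadgetState-⊑ β⊑β' λ spent≡0 ≤budget →
    untouched spent≡0 (≤-trans (+-mono-≤ (count-mono A) (+-mono-≤ (count-mono B) (count-mono C))) ≤budget)

  record Simulation (β : Colouring) : Set where
    field
      seeds blues : Subset n
      spent       : Fin n → ℕ
      reach       : Reach 1 (adj G) seeds blues
      covers      : ∀ i → β (vV i) ≡ true → lookup blues i ≡ true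
      cost        : ∣ seeds ∣ ≤ ∣ seedsV ∣ + sum spent
      states      : ∀ i → GadgetState β i (spent i)

  initial : Simulation σ
  initial = record
    { seeds  = seedsV ; blues = seedsV ; spent = λ _ → 0 ; reach = start
    ; covers = λ i σvi → trans (lookup∘tabulate (σ ∘ vV) i) σvi
    ; cost   = m≤m+n _ _
    ; states = λ _ → untouched refl ≤-refl }

  Simulation-cong : ∀ {β β'} → (∀ w → β w ≡ β' w) → Simulation β → Simulation β'
  Simulation-cong {β} {β'} β≗β' sim = record
    { seeds = seeds ; blues = blues ; spent = spent ; reach = reach ; cost = cost
    ; covers = λ i vi → covers i (trans (β≗β' (vV i)) vi)
    ; states = λ i → GadgetState-mono (⊑-≗ β≗β') (⊑⇒⊑[ i ] (⊑-≗ (sym ∘ β≗β'))) (states i) }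
    where
    open Simulation sim
    ⊑-≗ : ∀ {γ γ'} → (∀ w → γ w ≡ γ' w) → γ ⊑ γ'
    ⊑-≗ γ≗γ' w γw = trans (sym (γ≗γ' w)) γw

  advance : ∀ {β} v (sim : Simulation β) (c : ℕ) {S T} → Reach 1 (adj G) S T →
            (∀ i → (β ⊕ v) (vV i) ≡ true → lookup T i ≡ true) →
            ∣ S ∣ ≤ ∣ Simulation.seeds sim ∣ + c →
            GadgetState (β ⊕ v) (owner v) (Simulation.spent sim (owner v) + c) →
            Simulation (β ⊕ v)
  advance {β} v sim c {S} {T} reach′ covers′ cost′ state = record
    { seeds = S ; blues = T ; spent = spent′ ; reach = reach′ ; covers = covers′
    ; cost = ≤-trans cost′ (≤-trans (+-monoˡ-≤ c cost)
               (≤-reflexive (trans (+-assoc ∣ seedsV ∣ (sum spent) c) (cong (∣ seedsV ∣ +_) (sym sum-spent′)))))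
    ; states = states′ }
    where
    open Simulation sim
    i = owner v
    bump : Fin n → ℕ
    bump k = if eqF i k then c else 0
    spent′ : Fin n → ℕ
    spent′ k = spent k + bump k
    sum-spent′ : sum spent′ ≡ sum spent + c
    sum-spent′ = trans (∑-distrib-+ spent bump)
                       (cong (sum spent +_) (sum-diagonal i (λ b _ → if b then c else 0) (λ _ → refl)))
    states′ : ∀ k → GadgetState (β ⊕ v) k (spent′ k)
    states′ k with i ≟ k
    ... | yes refl = state
    ... | no  i≢k  = subst (GadgetState (β ⊕ v) k) (sym (+-identityʳ (spent k)))
                           (GadgetState-mono (⊑⊕ β v) (⊕⊑[ k ] β v i≢k) (states k))

  advance₀ : ∀ {β} v (sim : Simulation β) →
             (∀ i → (β ⊕ v) (vV i) ≡ true → lookup (Simulation.blues sim) i ≡ true) →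
             GadgetState (β ⊕ v) (owner v) (Simulation.spent sim (owner v)) →
             Simulation (β ⊕ v)
  advance₀ v sim covers′ state =
    advance v sim 0 reach covers′ (m≤m+n _ 0) (subst (GadgetState _ (owner v)) (sym (+-identityʳ _)) state)
    where open Simulation sim

  whiteG∸1≤blueA : ∀ {β} i → whites (vV i) β ≤ suc Q → whiteG i β ∸ 1 ≤ blueA i β
  whiteG∸1≤blueA {β} i whites≤q = ∸-monoˡ-≤ 1 (+-cancelʳ-≤ (whiteA i β) (whiteG i β) (suc (blueA i β))
    (subst (λ t → whiteG i β + whiteA i β ≤ suc t) (sym (count-complement (λ j → β (vA i j))))
           (subst (_≤ suc Q) (whites-vV i β) whites≤q)))

  white-vi+Q≤blueAB : ∀ {β i j} → β (vA i j) ≡ true → whites (vA i j) β ≤ suc Q →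
                      toℕ (not (β (vV i))) + Q ≤ blueA i β + blueB i β
  white-vi+Q≤blueAB {β} {i} {j} a-blue whites≤q = +-cancelʳ-≤ (suc Q) (vi-white + Q) (blueA i β + blueB i β) (begin
    vi-white + Q + suc Q
      ≡⟨ cong₂ (λ x y → vi-white + x + y) (count-complement (λ j → β (vA i j)))
                                           (count-complement (λ j → β (vB i j))) ⟨
    vi-white + (blueA i β + whiteA i β) + (blueB i β + whiteB i β)
      ≡⟨ rearrange vi-white (blueA i β) (whiteA i β) (blueB i β) (whiteB i β) ⟩
    vi-white + (whiteA i β + whiteB i β) + (blueA i β + blueB i β)
      ≤⟨ +-monoˡ-≤ _ (subst (_≤ suc Q) (whites-vA i j β a-blue) whites≤q) ⟩
    suc Q + (blueA i β + blueB i β)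
      ≡⟨ +-comm (suc Q) _ ⟩
    blueA i β + blueB i β + suc Q ∎)
    where
    open ≤-Reasoning
    vi-white = toℕ (not (β (vV i)))
    rearrange : ∀ w a a' b b' → w + (a + a') + (b + b') ≡ w + (a' + b') + (a + b)
    rearrange = solve-∀

  1+Q≤blueBC : ∀ {β i} → whiteB i β + whiteC i β ≤ suc Q → suc Q ≤ blueB i β + blueC i β
  1+Q≤blueBC {β} {i} whites≤q = +-cancelʳ-≤ (whiteB i β + whiteC i β) (suc Q) (blueB i β + blueC i β) (begin
    suc Q + (whiteB i β + whiteC i β)                   ≤⟨ +-monoʳ-≤ (suc Q) whites≤q ⟩
    suc Q + suc Q                                       ≡⟨ cong₂ _+_ (count-complement (λ j → β (vB i j)))
                                                                     (count-complement (λ j → β (vC i j))) ⟨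
    (blueB i β + whiteB i β) + (blueC i β + whiteC i β) ≡⟨ rearrange (blueB i β) (whiteB i β) _ _ ⟩
    blueB i β + blueC i β + (whiteB i β + whiteC i β)   ∎)
    where
    open ≤-Reasoning
    rearrange : ∀ b b' c c' → (b + b') + (c + c') ≡ b + c + (b' + c')
    rearrange = solve-∀

  affordable-vV : ∀ {β i spent} → whites (vV i) β ≤ suc Q → GadgetState β i spent →
                  spent + (whiteG i β ∸ 1) ≤ budget i
  affordable-vV {β} {i} {spent} whites≤q state with state
  ... | untouched spent≡0 ≤budget rewrite spent≡0 =
    ≤-trans (whiteG∸1≤blueA {β} i whites≤q) (≤-trans (m≤m+n _ _) ≤budget)
  ... | paid ≤budget =
    ≤-trans (+-monoʳ-≤ spent (≤-trans (whiteG∸1≤blueA {β} i whites≤q) (count≤ _))) (≤-trans (m≤m+n _ _) ≤budget)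
  ... | done ≤budget _ nbrs =
    subst (_≤ budget i) (sym (trans (cong (λ x → spent + (x ∸ 1)) whiteG≡0) (+-identityʳ spent))) ≤budget
    where
    whiteG≡0 : whiteG i β ≡ 0
    whiteG≡0 = count-false λ i' → nbr-blue (adj G i i') (nbrs i')
      where
      nbr-blue : ∀ a {b} → (a ≡ true → b ≡ true) → a ∧ not b ≡ false
      nbr-blue false a⇒b = refl
      nbr-blue true  a⇒b = cong not (a⇒b refl)

  step-vV : ∀ {β} i → β (vV i) ≡ true → whites (vV i) β ≤ suc Q → Simulation β → Simulation (β ⊕ vV i)
  step-vV {β} i vi-blue whites≤q sim
    with force-after-seeding i (Simulation.reach sim)
           (lookup⇒[]= i (Simulation.blues sim) (Simulation.covers sim i vi-blue))
  ... | X , reach′ , ∣X∣≡ =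
    advance (vV i) sim ∣ X ∣ reach′ covers′ (∣p∪q∣≤∣p∣+∣q∣ seeds X)
            (done (≤-trans (+-monoʳ-≤ (spent i) ∣X∣≤) (affordable-vV whites≤q (states i)))
                  (⊑⊕ β (vV i) (vV i) vi-blue) (λ i' a → trans (cong (β (vV i') ∨_) a) (∨-zeroʳ _)))
    where
    open Simulation sim
    covers′ : ∀ i' → (β ⊕ vV i) (vV i') ≡ true → lookup ((blues ∪ X) ∪ nbhd (adj G) i) i' ≡ true
    covers′ i' h with β (vV i') in vi'
    ... | true  = []=⇒lookup (p⊆p∪q _ (p⊆p∪q X (lookup⇒[]= i' blues (covers i' vi'))))
    ... | false = []=⇒lookup (q⊆p∪q (blues ∪ X) (nbhd (adj G) i)
                                    (lookup⇒[]= i' _ (trans (lookup∘tabulate (adj G i) i') h)))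
    ∣X∣≤ : ∣ X ∣ ≤ whiteG i β ∸ 1
    ∣X∣≤ = subst (_≤ whiteG i β ∸ 1) (sym ∣X∣≡) (∸-monoˡ-≤ 1 (≤-trans (≤-reflexive (white-count (adj G) i blues))
             (count-mono λ i' → still-white (adj G i i') (covers i'))))
      where
      still-white : ∀ a {b t} → (b ≡ true → t ≡ true) → a ∧ not t ≡ true → a ∧ not b ≡ true
      still-white true {true}  b⇒t h = subst (λ t → not t ≡ true) (b⇒t refl) h
      still-white true {false} b⇒t h = refl

  paid′ : ∀ {β i spent} → β (vV i) ≡ true → spent + Q ≤ budget i → GadgetState β i spent
  paid′ {β} {i} {spent} vi ≤budget =
    paid (subst (λ b → spent + Q + toℕ (not b) ≤ budget i) (sym vi)
                (subst (_≤ budget i) (sym (+-identityʳ _)) ≤budget))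

  step-vA : ∀ {β} i j → β (vA i j) ≡ true → whites (vA i j) β ≤ suc Q → Simulation β → Simulation (β ⊕ vA i j)
  step-vA {β} i j a-blue whites≤q sim = advance (vA i j) sim vi-white (Reach-∪ I reach) covers′ cost′ state′
    where
    open Simulation sim
    vi-white = toℕ (not (β (vV i)))
    I : Subset n
    I = tabulate (λ k → eqF i k ∧ not (β (vV i)))
    cost′ : ∣ seeds ∪ I ∣ ≤ ∣ seeds ∣ + vi-white
    cost′ = ≤-trans (∣p∪q∣≤∣p∣+∣q∣ seeds I) (+-monoʳ-≤ _ (≤-reflexive
              (trans (∣tabulate∣≡count (λ k → eqF i k ∧ not (β (vV i))))
                     (sum-diagonal i (λ b _ → toℕ (b ∧ not (β (vV i)))) (λ _ → refl)))))
    covers′ : ∀ i' → (β ⊕ vA i j) (vV i') ≡ true → lookup (blues ∪ I) i' ≡ true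
    covers′ i' h with β (vV i') in vi'
    ... | true  = []=⇒lookup (p⊆p∪q I (lookup⇒[]= i' blues (covers i' vi')))
    ... | false with eqF⇒≡ {i = i} {i'} h
    ...   | refl = []=⇒lookup (q⊆p∪q blues I (lookup⇒[]= i I
                     (trans (lookup∘tabulate _ i) (cong₂ (λ e b → e ∧ not b) (eqF-refl i) vi'))))
    vi′ : (β ⊕ vA i j) (vV i) ≡ true
    vi′ = trans (cong (β (vV i) ∨_) (eqF-refl i)) (∨-zeroʳ _)
    blueAB≤ : ∀ γ → blueA i γ + blueB i γ ≤ blueGadget i γ
    blueAB≤ γ = +-monoʳ-≤ (blueA i γ) (m≤m+n (blueB i γ) (blueC i γ))
    state′ : GadgetState (β ⊕ vA i j) i (spent i + vi-white)
    state′ with states i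
    ... | untouched spent≡0 ≤budget rewrite spent≡0 =
      paid′ vi′ (≤-trans (white-vi+Q≤blueAB {β} {i} {j} a-blue whites≤q) (≤-trans (blueAB≤ β) ≤budget))
    ... | paid ≤budget = paid′ vi′ (≤-trans (≤-reflexive (swap (spent i) vi-white Q)) ≤budget)
      where
      swap : ∀ a b c → a + b + c ≡ a + c + b
      swap = solve-∀
    ... | done ≤budget vi nbrs =
      done (≤-trans (≤-reflexive (trans (cong (λ b → spent i + toℕ (not b)) vi) (+-identityʳ _))) ≤budget)
           vi′ (λ i' a → ⊑⊕ β (vA i j) (vV i') (nbrs i' a))

  step-BC : ∀ {β} v → (∀ i' → adjStarV G (suc Q) v (vV i') ≡ false) →
            whiteB (owner v) β + whiteC (owner v) β ≤ suc Q → Simulation β → Simulation (β ⊕ v)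
  step-BC {β} v no-V whites-BC sim =
    advance₀ v sim covers′ (GadgetState-⊑ (⊑⊕ β v) start-paying (states i))
    where
    open Simulation sim
    i = owner v
    covers′ : ∀ i' → (β ⊕ v) (vV i') ≡ true → lookup blues i' ≡ true
    covers′ i' h = covers i' (trans (sym (∨-identityʳ _)) (trans (cong (β (vV i') ∨_) (sym (no-V i'))) h))
    start-paying : spent i ≡ 0 → blueGadget i β ≤ budget i → GadgetState (β ⊕ v) i (spent i)
    start-paying spent≡0 ≤budget rewrite spent≡0 =
      paid (≤-trans (+-monoʳ-≤ Q (toℕ≤1 (not ((β ⊕ v) (vV i)))))
           (≤-trans (≤-reflexive (+-comm Q 1))
                    (≤-trans (1+Q≤blueBC {β} {i} whites-BC) (≤-trans (m≤n+m _ (blueA i β)) ≤budget))))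

  step-any : ∀ {β} v → β v ≡ true → whites v β ≤ suc Q → Simulation β → Simulation (β ⊕ v)
  step-any (vV i)   = step-vV i
  step-any (vA i j) = step-vA i j
  step-any {β} (vB i j) b-blue whites≤q =
    step-BC (vB i j) (λ _ → refl) (m+n≤o⇒n≤o (whiteA i β) (subst (_≤ suc Q) (whites-vB i j β b-blue) whites≤q))
  step-any {β} (vC i j) c-blue whites≤q =
    step-BC (vC i j) (λ _ → refl) (subst (_≤ suc Q) (whites-vC i j β c-blue) whites≤q)

  simulation : ∀ {B} → Reach (suc Q) adj* S* B → Simulation (colouring B)
  simulation start = initial
  simulation (step {B} u r u∈B whites≤q) =
    subst (λ x → Simulation (colouring (B ∪ nbhd adj* x))) u≡
      (Simulation-cong (sym ∘ colouring-force B v)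
        (step-any v (subst (λ x → lookup B x ≡ true) (sym u≡) ([]=⇒lookup u∈B))
                    (subst (_≤ suc Q) (trans (cong (λ x → ∣ nbhd adj* x ∩ ∁ B ∣) (sym u≡)) (whites-encode v B))
                                      whites≤q)
                    (simulation r)))
    where
    v = decode n (suc Q) u
    u≡ : encode v ≡ u
    u≡ = encode-decode {n} {suc Q} u

  ∣S*∣ : ∣ S* ∣ ≡ ∣ seedsV ∣ + sum budget
  ∣S*∣ = begin
    ∣ S* ∣                       ≡⟨ ∣p∣≡count S* ⟩
    count (lookup S*)            ≡⟨ sum-encode {n} {suc Q} _ ⟩
    ∑Vtx (toℕ ∘ σ)               ≡⟨ cong₂ _+_ (∣tabulate∣≡count (σ ∘ vV))
                                              (cong (sum (λ i → blueA i σ) +_) (∑-distrib-+ (λ i → blueB i σ) _)) ⟨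
    ∣ seedsV ∣ + (sum (λ i → blueA i σ) + sum (λ i → blueB i σ + blueC i σ))
                                 ≡⟨ cong (∣ seedsV ∣ +_) (∑-distrib-+ (λ i → blueA i σ) _) ⟨
    ∣ seedsV ∣ + sum budget      ∎
    where open ≡-Reasoning

  zero-forcing-set : IsForcingSet (suc Q) adj* S* → ∃ λ S → IsForcingSet 1 (adj G) S × ∣ S ∣ ≤ ∣ S* ∣
  zero-forcing-set forcing =
    seeds , subst (Reach 1 (adj G) seeds) blues≡⊤ reach ,
    ≤-trans cost (≤-trans (+-monoʳ-≤ ∣ seedsV ∣ (sum-mono-≤ (spent≤budget ∘ states))) (≤-reflexive (sym ∣S*∣)))
    where
    open Simulation (simulation forcing)
    blues≡⊤ : blues ≡ ⊤
    blues≡⊤ = ⊆-antisym ⊆⊤ λ {i} _ → lookup⇒[]= i blues (covers i (lookup-replicate (encode (vV i)) true))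

lemma3p1 : (G : Graph) (q : ℕ) → 2 ≤ q → (k : ℕ) →
    (IsZeroForcingNumber G k → IsForcingNumber q (adjStar G q) k)
    × (IsForcingNumber q (adjStar G q) k → IsZeroForcingNumber G k)
lemma3p1 G (suc (suc Q)) (s≤s (s≤s z≤n)) k =
  forcing-number-transfer lift lift-forcing ∣lift∣ (Forcing⇒ZeroForcing.zero-forcing-set G (suc Q))
  where open ZeroForcing⇒Forcing G (suc Q) zero
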